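{- Let $q$ be a power of a prime $p$, and let $k=d\cdot q+r$ with integers $0\le d<q$ and $0\le r<q-d$. Then for every $0\le i\le r$, every $0\le j\le d$ and every $j+1\le l\le d$, $p$ divides $\binom{k-i}{k-j-l(q-1)}$. -}

module Defs where

open import Data.Nat using (ℕ)
open import Data.Integer using (ℤ; +_; -[1+_])
open import Data.Nat.Combinatorics using (_C_)

-- Binomial coefficient with natural upper index and integer lower index,
-- with the standard convention  binom n m = 0  for m < 0.
-- (For m > n, stdlib's _C_ already gives 0.)
binomℤ : ℕ → ℤ → ℕ
binomℤ n (+ m)    = n C m
binomℤ n -[1+ m ] = 0

module Submission where

-- Write q = p ^ e.  The theorem is a Lucas-type vanishing
-- statement: p divides C(a·q + t, b·q + s) whenever t < s < q, i.e. whenever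
-- the "low digit" of the lower index exceeds that of the upper one.
--
--  * Base case t = 0 (and more generally): if q ∣ m but q ∤ k, then p ∣ C(m, k).
--    By the absorption identity  k · C(m, k) = m · C(m-1, k-1)  we get
--    q ∣ k · C(m, k); were p ∤ C(m, k), the prime-power form of Euclid's lemma
--    would give q ∣ k.
--  * Step t → t+1: Pascal's rule splits C(aq+t+1, bq+s) into two binomials
--    that are covered by the induction hypothesis.
--
-- The theorem follows by writing  d = l + d',  l = j + 1 + l',  r = i + t :
-- the upper index is d·q + t and the lower index is d'·q + s with
-- s = i + t + l' + 1, and  t < s ≤ r + d < q.

open import Defs
open import Data.Nat using (ℕ; _+_; _*_; _∸_; _^_; _≤_; _<_)
open import Relation.Binary.PropositionalEquality using (_≡_)
open import Data.Nat.Divisibility using (_∣_)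
open import Data.Nat.Primality using (Prime)
open import Data.Integer using (+_) renaming (_-_ to _-ℤ_; _*_ to _*ℤ_)

open import Data.Nat using (zero; suc; s≤s; >-nonZero)
open import Data.Nat.Properties
open import Data.Nat.Divisibility
  using (divides; _∣?_; ∣-trans; 1∣_; _∣0; m∣m*n; n∣m*n;
         *-monoʳ-∣; *-cancelʳ-∣; ∣m∣n⇒∣m+n; ∣m+n∣m⇒∣n; ∣⇒≤)
open import Data.Nat.Primality using (euclidsLemma; prime⇒nonZero)
open import Data.Nat.Combinatorics using (_C_; nC1≡n)
  renaming (nCk+nC[k+1]≡[n+1]C[k+1] to pascal)
open import Relation.Binary.PropositionalEquality
  using (refl; sym; trans; cong; cong₂; subst; subst₂; module ≡-Reasoning)
open import Relation.Nullary using (¬_; yes; no; contradiction)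
open import Data.Sum using (inj₁; inj₂)
open import Data.Product using (_,_)
import Data.Integer.Properties as ℤ
open import Data.Nat.Solver using (module +-*-Solver)
import Data.Integer.Solver as ℤSolver

absorption : ∀ n k → suc k * (suc n C suc k) ≡ suc n * (n C k)
absorption zero    zero    = refl
absorption zero    (suc k) = *-zeroʳ (suc (suc k))
absorption (suc n) zero    =
  trans (+-identityʳ _) (trans (nC1≡n (suc (suc n))) (sym (*-identityʳ _)))
absorption (suc n) (suc k) = begin
  (2 + k) * ((2 + n) C (2 + k))
    ≡⟨ cong ((2 + k) *_) (sym (pascal (suc n) (suc k))) ⟩
  (2 + k) * (A + B)
    ≡⟨ solve 3 (λ k A B → (con 2 :+ k) :* (A :+ B)
                        := ((con 1 :+ k) :* A :+ (con 2 :+ k) :* B) :+ A) refl k A B ⟩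
  ((1 + k) * A + (2 + k) * B) + A
    ≡⟨ cong (_+ A) (cong₂ _+_ (absorption n k) (absorption n (suc k))) ⟩
  ((1 + n) * (n C k) + (1 + n) * (n C suc k)) + A
    ≡⟨ cong (_+ A) (sym (*-distribˡ-+ (1 + n) (n C k) (n C suc k))) ⟩
  (1 + n) * (n C k + n C suc k) + A
    ≡⟨ cong (λ x → (1 + n) * x + A) (pascal n k) ⟩
  (1 + n) * A + A
    ≡⟨ +-comm ((1 + n) * A) A ⟩
  (2 + n) * A ∎
  where
  open ≡-Reasoning
  open +-*-Solver
  A B : ℕ
  A = suc n C suc k
  B = suc n C suc (suc k)

prime-power-euclid : ∀ {p} e m c → Prime p → p ^ e ∣ m * c → ¬ p ∣ c → p ^ e ∣ m
prime-power-euclid zero    m c pp _      _   = 1∣ m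
prime-power-euclid {p} (suc e) m c pp p^e∣mc p∤c
  with euclidsLemma m c pp (∣-trans (m∣m*n (p ^ e)) p^e∣mc)
... | inj₂ p∣c                 = contradiction p∣c p∤c
... | inj₁ (divides m′ refl) =
  subst (p * p ^ e ∣_) (*-comm p m′)
    (*-monoʳ-∣ p (prime-power-euclid e m′ c pp p^e∣m′c p∤c))
  where
  instance _ = prime⇒nonZero pp
  rearranged : p ^ e * p ∣ (m′ * c) * p
  rearranged = subst₂ _∣_ (*-comm p (p ^ e))
    (solve 3 (λ m′ p c → (m′ :* p) :* c := (m′ :* c) :* p) refl m′ p c) p^e∣mc
    where open +-*-Solver
  p^e∣m′c : p ^ e ∣ m′ * c
  p^e∣m′c = *-cancelʳ-∣ p rearranged

binom-divisible : ∀ {p} e m k → Prime p → p ^ e ∣ m → ¬ p ^ e ∣ k → p ∣ m C k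
binom-divisible e m       zero    pp q∣m q∤k = contradiction (_ ∣0) q∤k
binom-divisible e zero    (suc k) pp q∣m q∤k = _ ∣0
binom-divisible {p} e (suc n) (suc k) pp q∣m q∤k with p ∣? (suc n C suc k)
... | yes p∣C = p∣C
... | no  p∤C = contradiction (prime-power-euclid e (suc k) _ pp q∣kC p∤C) q∤k
  where
  q∣kC : p ^ e ∣ suc k * (suc n C suc k)
  q∣kC = subst (p ^ e ∣_) (sym (absorption n k)) (∣-trans q∣m (m∣m*n (n C k)))

module _ {p e q : ℕ} (pp : Prime p) (q≡p^e : q ≡ p ^ e) (a b : ℕ) where

  not-multiple : ∀ s → 0 < s → s < q → ¬ q ∣ b * q + s
  not-multiple s 0<s s<q q∣bq+s =
    <⇒≱ s<q (∣⇒≤ {{>-nonZero 0<s}} (∣m+n∣m⇒∣n q∣bq+s (n∣m*n b)))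

  lucas-vanishing : ∀ t s → t < s → s < q → p ∣ (a * q + t) C (b * q + s)
  lucas-vanishing zero s 0<s s<q =
    binom-divisible e (a * q + 0) (b * q + s) pp
      (subst₂ _∣_ q≡p^e (sym (+-identityʳ (a * q))) (n∣m*n a))
      (λ p^e∣ → not-multiple s 0<s s<q (subst (_∣ b * q + s) (sym q≡p^e) p^e∣))
  lucas-vanishing (suc t) (suc s) (s≤s t<s) s+1<q
    rewrite +-suc (a * q) t | +-suc (b * q) s =
    subst (p ∣_) (pascal (a * q + t) (b * q + s))
      (∣m∣n⇒∣m+n (lucas-vanishing t s t<s (<-trans (n<1+n s) s+1<q))
                 (subst (λ x → p ∣ (a * q + t) C x) (+-suc (b * q) s)
                        (lucas-vanishing t (suc s) (m<n⇒m<1+n t<s) s+1<q)))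

upper-index : ∀ x i t → (x + (i + t)) ∸ i ≡ x + t
upper-index x i t =
  trans (cong (_∸ i) (solve 3 (λ x i t → x :+ (i :+ t) := i :+ (x :+ t)) refl x i t))
        (m+n∸m≡n i (x + t))
  where open +-*-Solver

cancel-summands : ∀ x y z → (+ (x + y + z) -ℤ + y) -ℤ + z ≡ + x
cancel-summands x y z rewrite ℤ.pos-+ (x + y) z | ℤ.pos-+ x y =
  solve 3 (λ x y z → ((x :+ y :+ z) :- y) :- z := x) refl (+ x) (+ y) (+ z)
  where open ℤSolver.+-*-Solver

lower-index : ∀ i t j l′ d′ q′ →
  (+ ((j + 1 + l′ + d′) * suc q′ + (i + t)) -ℤ + j) -ℤ (+ (j + 1 + l′) *ℤ + q′)
    ≡ + (d′ * suc q′ + suc (i + t + l′))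
lower-index i t j l′ d′ q′ =
  trans (cong₂ (λ n m → (+ n -ℤ + j) -ℤ m) regroup (sym (ℤ.pos-* (j + 1 + l′) q′)))
        (cancel-summands (d′ * suc q′ + suc (i + t + l′)) j ((j + 1 + l′) * q′))
  where
  open +-*-Solver
  regroup : (j + 1 + l′ + d′) * suc q′ + (i + t)
          ≡ (d′ * suc q′ + suc (i + t + l′)) + j + (j + 1 + l′) * q′
  regroup = solve 6 (λ j l′ d′ q′ i t →
              ((j :+ con 1 :+ l′) :+ d′) :* (con 1 :+ q′) :+ (i :+ t)
              := (d′ :* (con 1 :+ q′) :+ (con 1 :+ (i :+ t :+ l′))) :+ j :+ (j :+ con 1 :+ l′) :* q′)
              refl j l′ d′ q′ i t

low-digit-bound : ∀ i t j l′ d′ → suc (i + t + l′) ≤ (i + t) + (j + 1 + l′ + d′)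
low-digit-bound i t j l′ d′ =
  ≤-trans (m≤m+n (suc (i + t + l′)) (j + d′)) (≤-reflexive (solve 5 (λ i t l′ j d′ →
    (con 1 :+ (i :+ t :+ l′)) :+ (j :+ d′) := (i :+ t) :+ ((j :+ con 1 :+ l′) :+ d′))
    refl i t l′ j d′))
  where open +-*-Solver

lemma4p14 : (p e q d r : ℕ) → Prime p → 1 ≤ e → q ≡ p ^ e → d < q → r + d < q →
    ∀ i j l → i ≤ r → j ≤ d → j + 1 ≤ l → l ≤ d →
    p ∣ binomℤ ((d * q + r) ∸ i) ((+ (d * q + r) -ℤ + j) -ℤ (+ l *ℤ + (q ∸ 1)))
lemma4p14 p e zero d r _ _ _ () _ _ _ _ _ _ _ _
lemma4p14 p e (suc q′) d r pp _ q≡p^e _ r+d<q i j l i≤r _ j<l l≤d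
  with m≤n⇒∃[o]m+o≡n l≤d | m≤n⇒∃[o]m+o≡n j<l | m≤n⇒∃[o]m+o≡n i≤r
... | d′ , refl | l′ , refl | t , refl =
  subst₂ (λ n m → p ∣ binomℤ n m)
    (sym (upper-index (d * suc q′) i t)) (sym (lower-index i t j l′ d′ q′))
    (lucas-vanishing {e = e} pp q≡p^e d d′ t (suc (i + t + l′)) t<s s<q)
  where
  t<s : t < suc (i + t + l′)
  t<s = s≤s (≤-trans (m≤n+m t i) (m≤m+n (i + t) l′))
  s<q : suc (i + t + l′) < suc q′
  s<q = ≤-<-trans (low-digit-bound i t j l′ d′) r+d<q
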